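{- Let $F$ be a $3$-graph such that for each $v\in V(F)$ there exists a vertex $u\in V(F)$ with $N_F(v)\cap N_F(u)\neq\emptyset$. Then for any $p\in(0,1)$ and $\mu>0$ there exist $n_0\in\mathbb{N}$ and $\alpha>0$ such that for all $n\ge n_0$ there exists an $(n,p,\mu,\cdot)$ $3$-graph $H$ with $\delta_1(H)\ge \alpha n^2$ such that $H$ has no $F$-factor.
   Context: A $k$-graph $H=(V,E)$ has $E\subseteq\binom{V}{k}$. For a set $S$ of vertices with $1\le |S|\le k-1$, $N_H(S)=\{S'\in\binom{V}{k-|S|}: S\cup S'\in E\}$ (for a single vertex $v$ write $N_H(v)$), $\deg_H(S)=|N_H(S)|$, and $\delta_s(H)$ is the minimum of $\deg_H(S)$ over all $s$-subsets $S$ of $V$. For $p\in[0,1]$, $\mu>0$, an $n$-vertex $k$-graph $H=(V,E)$ is an $(n,p,\mu,\cdot)$ $k$-graph (i.e. $(p,\mu,\cdot)$-dense) if for all $X_1,\dots,X_k\subseteq V$, the number of tuples $(x_1,\dots,x_k)\in X_1\times\cdots\times X_k$ with $\{x_1,\dots,x_k\}\in E$ is at least $p|X_1|\cdots|X_k|-\mu n^k$. An $F$-factor in $H$ is a set of vertex-disjoint copies of $F$ in $H$ covering $V(H)$.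
   Formalization: The parameters p and μ range over the rationals, and the constant α is taken in the rationals as well. -}

module Defs where

open import Data.Nat as ℕ using (ℕ; zero; suc; _<ᵇ_)
open import Data.Bool using (Bool; true; false; _∧_; if_then_else_)
open import Data.Fin using (Fin; toℕ)
open import Data.Fin.Subset using (Subset; _∈_; ∣_∣)
open import Data.Vec using (lookup)
open import Data.List using (List; map)
open import Data.Nat.ListAction using (sum)
open import Data.List.Base using (allFin)
open import Data.Integer using (+_)
open import Data.Rational using (ℚ; _/_; _*_; _-_; _≥_; _≤_)
open import Data.Product using (Σ; _×_; _,_; ∃)
open import Relation.Binary.PropositionalEquality using (_≡_; _≢_)
open import Function.Definitions using (Injective)

ℕtoℚ : ℕ → ℚ
ℕtoℚ n = (+ n) / 1

ΣFin : (n : ℕ) → (Fin n → ℕ) → ℕ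
ΣFin n f = sum (map f (allFin n))

⟦_⟧ : Bool → ℕ
⟦ true ⟧ = 1
⟦ false ⟧ = 0

-- A 3-graph on vertex set Fin m, given by the (decidable) indicator of
-- {x,y,z} ∈ E, as a symmetric function on ordered triples that vanishes
-- on triples with a repeated vertex (edges are 3-element sets).
record 3Graph (m : ℕ) : Set where
  field
    E        : Fin m → Fin m → Fin m → Bool
    sym₁₂    : ∀ x y z → E x y z ≡ E y x z
    sym₂₃    : ∀ x y z → E x y z ≡ E x z y
    loopless : ∀ x z → E x x z ≡ false
open 3Graph public

-- deg_H(v) = |N_H(v)| = number of 2-sets {a,b} (a < b) with {v,a,b} ∈ E
deg : ∀ {m} → 3Graph m → Fin m → ℕ
deg {m} H v = ΣFin m λ a → ΣFin m λ b →
  ⟦ (toℕ a <ᵇ toℕ b) ∧ E H v a b ⟧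

MinDeg≥ : ∀ {m} → 3Graph m → ℚ → Set
MinDeg≥ {m} H α = ∀ v → ℕtoℚ (deg H v) ≥ α * ℕtoℚ (m ℕ.* m)

eH : ∀ {m} → 3Graph m → Subset m → Subset m → Subset m → ℕ
eH {m} H X₁ X₂ X₃ = ΣFin m λ x₁ → ΣFin m λ x₂ → ΣFin m λ x₃ →
  ⟦ lookup X₁ x₁ ∧ lookup X₂ x₂ ∧ lookup X₃ x₃ ∧ E H x₁ x₂ x₃ ⟧

Dense : ∀ {m} → 3Graph m → ℚ → ℚ → Set
Dense {m} H p μ = ∀ (X₁ X₂ X₃ : Subset m) →
  ℕtoℚ (eH H X₁ X₂ X₃) ≥
    p * ℕtoℚ (∣ X₁ ∣ ℕ.* ∣ X₂ ∣ ℕ.* ∣ X₃ ∣) - μ * ℕtoℚ (m ℕ.* m ℕ.* m)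

IsCopy : ∀ {f m} → 3Graph f → 3Graph m → (Fin f → Fin m) → Set
IsCopy F H φ = Injective _≡_ _≡_ φ ×
  (∀ a b c → E F a b c ≡ true → E H (φ a) (φ b) (φ c) ≡ true)

HasFactor : ∀ {f m} → 3Graph f → 3Graph m → Set
HasFactor {f} {m} F H = Σ ℕ λ t → Σ (Fin t → Fin f → Fin m) λ φ →
  (∀ i → IsCopy F H (φ i)) ×
  (∀ i j a b → φ i a ≡ φ j b → (i ≡ j) × (a ≡ b)) ×
  (∀ v → Σ (Fin t) λ i → Σ (Fin f) λ a → φ i a ≡ v)

SharedLinkPair : ∀ {f} → 3Graph f → Set
SharedLinkPair {f} F = ∀ (v : Fin f) → Σ (Fin f) λ u → u ≢ v ×
  Σ (Fin f) λ a → Σ (Fin f) λ b → (E F v a b ≡ true) × (E F u a b ≡ true)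

{-# OPTIONS --safe #-}
-- Fix a vertex o and a set A of k ≈ n/M further vertices, and let H consist of all triples avoiding o
-- with at most one vertex in A, together with the triples {o, a, a'} with a, a' ∈ A. Only O(k n²) ordered
-- triples are non-edges, so H is (p, μ)-dense for every p ≤ 1 once M ≫ 1/μ. The link of o is a clique
-- on A and the link of any other vertex contains a clique on V ∖ (A ∪ {o}), so δ₁(H) = Ω(k²) = Ω(n²/M²).
-- In an F-factor, the copy of F covering o maps some v to o and, as the link of o lies inside A, a pair
-- {a, b} ∈ N_F(v) into A. The vertex u ≠ v with {a, b} ∈ N_F(u) is not mapped to o, so {u, a, b} lands
-- on a triple avoiding o with two vertices in A, which is not an edge.

module Submission where

open import Defs
open import Data.Nat using (ℕ; _≥_)
open import Data.Rational using (ℚ; 0ℚ; 1ℚ; _<_)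
open import Data.Product using (Σ; _×_)
open import Relation.Nullary using (¬_)

open import Data.Bool using (Bool; true; false; not; _∧_)
open import Data.Bool.Properties using (T-≡)
open import Data.Empty using (⊥-elim)
open import Data.Fin using (Fin; zero; suc; toℕ; _≟_)
open import Data.Fin.Properties using (toℕ-injective)
open import Data.Fin.Subset using (Subset; ∣_∣)
open import Data.Integer as ℤ using (+[1+_])
import Data.Integer.Properties as ℤ
open import Data.List using (tabulate)
open import Data.List.Properties using (map-tabulate)
open import Data.Nat as ℕ
  using (zero; suc; _+_; _*_; _∸_; _≤_; z≤n; s≤s; _<ᵇ_; _/_; _%_; NonZero; >-nonZero)
open import Data.Nat.Coprimality as Coprime using (Coprime; 1-coprimeTo)
open import Data.Nat.DivMod using (m≡m%n+[m/n]*n; m%n<n; m/n*n≤m; m≥n⇒m/n>0)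
import Data.Nat.ListAction as List
open import Data.Nat.Properties as ℕ
  using ( ≤-refl; ≤-reflexive; ≤-trans; +-mono-≤; +-monoˡ-≤; *-mono-≤; *-monoˡ-≤; *-monoʳ-≤
        ; +-assoc; +-identityʳ; *-identityʳ; *-zeroʳ; m≤m+n; m≤n+m; m≤m*n; m≤n*m
        ; m+n≤o⇒m≤o; m+n≤o⇒m≤o∸n; n≢0⇒n>0; <-cmp; <⇒<ᵇ; _≤?_
        ; *-comm; n≤1+n; <⇒≤; ≤-pred; *-cancelˡ-≤; +-cancelˡ-≤
        ; +-0-commutativeMonoid; +-commutativeSemigroup; +-*-semiring; module ≤-Reasoning)
open import Data.Nat.Tactic.RingSolver using (solve-∀)
open import Data.Product using (∃; _,_; proj₁; proj₂)
import Data.Rational as ℚ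
import Data.Rational.Properties as ℚ
import Data.Rational.Unnormalised as ℚᵘ
import Data.Rational.Unnormalised.Properties as ℚᵘ
open import Data.Sum using (_⊎_; inj₁; inj₂)
open import Data.Vec using ([]; _∷_; lookup)
open import Function using (_∘_; id; Equivalence; mk⇔)
open import Relation.Binary.Definitions using (tri<; tri≈; tri>)
open import Relation.Binary.PropositionalEquality
open import Relation.Nullary using (Dec; yes; no)
open import Relation.Nullary.Decidable using (does; ¬?; _×-dec_; _⊎-dec_; does-⇔; dec-true; dec-false)
open import Relation.Unary using (Decidable)
open import Algebra.Properties.CommutativeMonoid.Sum +-0-commutativeMonoid
  using (sum; sum-syntax; ∑-distrib-+; ∑-comm; sum-cong-≗; sum-replicate-zero)
open import Algebra.Properties.CommutativeSemigroup +-commutativeSemigroup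
  using (xy∙z≈yx∙z; xy∙z≈xz∙y)
open import Algebra.Properties.Group ℚ.+-0-group using (//-rightDividesʳ)
open import Algebra.Properties.Semiring.Sum +-*-semiring using (*-distribˡ-sum; *-distribʳ-sum)

ΣFin≡∑ : ∀ n (f : Fin n → ℕ) → ΣFin n f ≡ ∑[ i < n ] f i
ΣFin≡∑ n f = trans (cong List.sum (map-tabulate id f)) (listSum-tabulate f)
  where
  listSum-tabulate : ∀ {n} (g : Fin n → ℕ) → List.sum (tabulate g) ≡ sum g
  listSum-tabulate {zero}  g = refl
  listSum-tabulate {suc n} g = cong (g zero +_) (listSum-tabulate (g ∘ suc))

∑-mono-≤ : ∀ {n} {f g : Fin n → ℕ} → (∀ i → f i ≤ g i) → sum f ≤ sum g
∑-mono-≤ {zero}  f≤g = z≤n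
∑-mono-≤ {suc n} f≤g = +-mono-≤ (f≤g zero) (∑-mono-≤ (f≤g ∘ suc))

∑-const : ∀ n c → ∑[ i < n ] c ≡ n * c
∑-const zero    c = refl
∑-const (suc n) c = cong (c +_) (∑-const n c)

∑-≤-const : ∀ {n c} {f : Fin n → ℕ} → (∀ i → f i ≤ c) → sum f ≤ n * c
∑-≤-const {n} {c} f≤c = ≤-trans (∑-mono-≤ f≤c) (≤-reflexive (∑-const n c))

∑-+-≤ : ∀ {n a b} {f g : Fin n → ℕ} → sum f ≤ a → sum g ≤ b → ∑[ i < n ] (f i + g i) ≤ a + b
∑-+-≤ {f = f} {g} f≤a g≤b = ≤-trans (≤-reflexive (∑-distrib-+ f g)) (+-mono-≤ f≤a g≤b)

∑-product : ∀ {n} (f g : Fin n → ℕ) → ∑[ a < n ] ∑[ b < n ] (f a * g b) ≡ sum f * sum g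
∑-product {n} f g = begin
  ∑[ a < n ] ∑[ b < n ] (f a * g b) ≡⟨ sum-cong-≗ (λ a → *-distribˡ-sum (f a) g) ⟨
  ∑[ a < n ] (f a * sum g)          ≡⟨ *-distribʳ-sum (sum g) f ⟨
  sum f * sum g                     ∎
  where open ≡-Reasoning

∑-indicator-≟ : ∀ {n} (a : Fin n) → ∑[ b < n ] ⟦ does (a ≟ b) ⟧ ≡ 1
∑-indicator-≟ {suc n} zero    = cong suc (sum-replicate-zero n)
∑-indicator-≟ {suc n} (suc a) = ∑-indicator-≟ a

∑-threshold : ∀ (g : Bool → ℕ) n k → k ≤ n →
              ∑[ x < n ] g (toℕ x <ᵇ k) ≡ k * g true + (n ∸ k) * g false
∑-threshold g zero    zero    _         = refl
∑-threshold g (suc n) zero    _         = cong (g false +_) (∑-const n (g false))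
∑-threshold g (suc n) (suc k) (s≤s k≤n) =
  trans (cong (g true +_) (∑-threshold g n k k≤n)) (sym (+-assoc (g true) _ _))

count : ∀ {n} → (Fin n → Bool) → ℕ
count {n} S = ∑[ a < n ] ⟦ S a ⟧

∣∣≡count : ∀ {n} (X : Subset n) → ∣ X ∣ ≡ count (lookup X)
∣∣≡count []          = refl
∣∣≡count (true ∷ X)  = cong suc (∣∣≡count X)
∣∣≡count (false ∷ X) = ∣∣≡count X

module _ {n : ℕ} where

  ∑² : (Fin n → Fin n → ℕ) → ℕ
  ∑² f = sum λ a → sum (f a)

  ∑²-mono-≤ : ∀ {f g} → (∀ a b → f a b ≤ g a b) → ∑² f ≤ ∑² g
  ∑²-mono-≤ f≤g = ∑-mono-≤ (∑-mono-≤ ∘ f≤g)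

  ∑²-+-≤ : ∀ {f g c e} → ∑² f ≤ c → ∑² g ≤ e → ∑² (λ a b → f a b + g a b) ≤ c + e
  ∑²-+-≤ {f} {g} f≤c g≤e =
    ≤-trans (∑-mono-≤ (λ a → ≤-reflexive (∑-distrib-+ (f a) (g a)))) (∑-+-≤ {n} f≤c g≤e)

  ∑²-≤-via-b : ∀ {f c} → (∀ a → ∑[ b < n ] f a b ≤ c) → ∑² f ≤ n * c
  ∑²-≤-via-b = ∑-≤-const

  ∑²-≤-via-a : ∀ {f c} → (∀ b → ∑[ a < n ] f a b ≤ c) → ∑² f ≤ n * c
  ∑²-≤-via-a {f} bound = ≤-trans (≤-reflexive (∑-comm f)) (∑-≤-const bound)

  ΣFin²≡∑² : ∀ f → ΣFin n (λ a → ΣFin n (f a)) ≡ ∑² f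
  ΣFin²≡∑² f = trans (ΣFin≡∑ n _) (sum-cong-≗ λ a → ΣFin≡∑ n (f a))

  ∑³ : (Fin n → Fin n → Fin n → ℕ) → ℕ
  ∑³ f = sum λ x → ∑² (f x)

  ΣFin³≡∑³ : ∀ f → ΣFin n (λ x → ΣFin n λ y → ΣFin n (f x y)) ≡ ∑³ f
  ΣFin³≡∑³ f = trans (ΣFin≡∑ n _) (sum-cong-≗ λ x → ΣFin²≡∑² (f x))

  ∑³-mono-≤ : ∀ {f g} → (∀ x y z → f x y z ≤ g x y z) → ∑³ f ≤ ∑³ g
  ∑³-mono-≤ f≤g = ∑-mono-≤ (∑²-mono-≤ ∘ f≤g)

  ∑³-distrib-+ : ∀ f g → ∑³ (λ x y z → f x y z + g x y z) ≡ ∑³ f + ∑³ g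
  ∑³-distrib-+ f g = begin
    ∑³ (λ x y z → f x y z + g x y z)
      ≡⟨ sum-cong-≗ (λ x → sum-cong-≗ λ y → ∑-distrib-+ (f x y) (g x y)) ⟩
    ∑[ x < n ] ∑[ y < n ] (∑[ z < n ] f x y z + ∑[ z < n ] g x y z)
      ≡⟨ sum-cong-≗ (λ x → ∑-distrib-+ (λ y → ∑[ z < n ] f x y z) _) ⟩
    ∑[ x < n ] (∑² (f x) + ∑² (g x))
      ≡⟨ ∑-distrib-+ (λ x → ∑² (f x)) _ ⟩
    ∑³ f + ∑³ g ∎
    where open ≡-Reasoning

  ∑³-+-≤ : ∀ {f g c e} → ∑³ f ≤ c → ∑³ g ≤ e → ∑³ (λ x y z → f x y z + g x y z) ≤ c + e
  ∑³-+-≤ {f} {g} f≤c g≤e = ≤-trans (≤-reflexive (∑³-distrib-+ f g)) (+-mono-≤ f≤c g≤e)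

  ∑³-product : ∀ (f g h : Fin n → ℕ) → ∑³ (λ x y z → f x * g y * h z) ≡ sum f * sum g * sum h
  ∑³-product f g h = begin
    ∑³ (λ x y z → f x * g y * h z)
      ≡⟨ sum-cong-≗ (λ x → sum-cong-≗ λ y → *-distribˡ-sum (f x * g y) h) ⟨
    ∑[ x < n ] ∑[ y < n ] (f x * g y * sum h)
      ≡⟨ sum-cong-≗ (λ x → *-distribʳ-sum (sum h) (λ y → f x * g y)) ⟨
    ∑[ x < n ] (∑[ y < n ] (f x * g y) * sum h)
      ≡⟨ *-distribʳ-sum (sum h) (λ x → ∑[ y < n ] (f x * g y)) ⟨
    ∑² (λ x y → f x * g y) * sum h
      ≡⟨ cong (_* sum h) (∑-product f g) ⟩
    sum f * sum g * sum h ∎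
    where open ≡-Reasoning

  ∑³-≤-via-z : ∀ {f c} → (∀ x y → ∑[ z < n ] f x y z ≤ c) → ∑³ f ≤ n * (n * c)
  ∑³-≤-via-z bound = ∑-≤-const (∑²-≤-via-b ∘ bound)

  ∑³-≤-via-y : ∀ {f c} → (∀ x z → ∑[ y < n ] f x y z ≤ c) → ∑³ f ≤ n * (n * c)
  ∑³-≤-via-y bound = ∑-≤-const (∑²-≤-via-a ∘ bound)

  ∑³-≤-via-x : ∀ {f c} → (∀ y z → ∑[ x < n ] f x y z ≤ c) → ∑³ f ≤ n * (n * c)
  ∑³-≤-via-x {f} bound =
    ≤-trans (≤-reflexive (∑-comm λ x y → ∑[ z < n ] f x y z)) (∑³-≤-via-y bound)

coprime-1 : ∀ n → Coprime n 1
coprime-1 n = Coprime.sym (1-coprimeTo n)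

ℕtoℚ≡mkℚ : ∀ n → ℕtoℚ n ≡ ℚ.mkℚ (ℤ.+ n) 0 (coprime-1 n)
ℕtoℚ≡mkℚ n = ℚ.normalize-coprime (coprime-1 n)

ℕtoℚ-nonNeg : ∀ n → ℚ.NonNegative (ℕtoℚ n)
ℕtoℚ-nonNeg n = ℚ.normalize-nonNeg n 1

ℕtoℚ-mono-≤ : ∀ {a b} → a ≤ b → ℕtoℚ a ℚ.≤ ℕtoℚ b
ℕtoℚ-mono-≤ {a} {b} a≤b rewrite ℕtoℚ≡mkℚ a | ℕtoℚ≡mkℚ b =
  ℚ.*≤* (subst₂ ℤ._≤_ (sym (ℤ.*-identityʳ (ℤ.+ a))) (sym (ℤ.*-identityʳ (ℤ.+ b)))
                      (ℤ.+≤+ a≤b))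

ℕtoℚ-homo-+ : ∀ a b → ℕtoℚ (a + b) ≡ ℕtoℚ a ℚ.+ ℕtoℚ b
ℕtoℚ-homo-+ a b rewrite ℕtoℚ≡mkℚ a | ℕtoℚ≡mkℚ b | ℕtoℚ≡mkℚ (a + b) =
  ℚ.toℚᵘ-injective (ℚᵘ.≃-trans (ℚᵘ.*≡* cross-multiplied)
    (ℚᵘ.≃-sym (ℚ.toℚᵘ-homo-+ (ℚ.mkℚ (ℤ.+ a) 0 (coprime-1 a))
                             (ℚ.mkℚ (ℤ.+ b) 0 (coprime-1 b)))))
  where
  cross-multiplied : ℤ.+ (a + b) ℤ.* ℤ.+ 1 ≡ (ℤ.+ a ℤ.* ℤ.+ 1 ℤ.+ ℤ.+ b ℤ.* ℤ.+ 1) ℤ.* ℤ.+ 1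
  cross-multiplied
    rewrite ℤ.*-identityʳ (ℤ.+ a) | ℤ.*-identityʳ (ℤ.+ b) | ℤ.*-identityʳ (ℤ.+ a ℤ.+ ℤ.+ b) =
    ℤ.pos-+ a b

ℕtoℚ-homo-* : ∀ a b → ℕtoℚ (a * b) ≡ ℕtoℚ a ℚ.* ℕtoℚ b
ℕtoℚ-homo-* a b rewrite ℕtoℚ≡mkℚ a | ℕtoℚ≡mkℚ b | ℕtoℚ≡mkℚ (a * b) =
  ℚ.toℚᵘ-injective (ℚᵘ.≃-trans (ℚᵘ.*≡* cross-multiplied)
    (ℚᵘ.≃-sym (ℚ.toℚᵘ-homo-* (ℚ.mkℚ (ℤ.+ a) 0 (coprime-1 a))
                             (ℚ.mkℚ (ℤ.+ b) 0 (coprime-1 b)))))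
  where
  cross-multiplied : ℤ.+ (a * b) ℤ.* ℤ.+ 1 ≡ (ℤ.+ a ℤ.* ℤ.+ b) ℤ.* ℤ.+ 1
  cross-multiplied rewrite ℤ.*-identityʳ (ℤ.+ (a * b)) | ℤ.*-identityʳ (ℤ.+ a ℤ.* ℤ.+ b) = ℤ.pos-* a b

1/suc : ℕ → ℚ
1/suc d = ℚ.mkℚ (ℤ.+ 1) d (1-coprimeTo (suc d))

1/suc-nonNeg : ∀ d → ℚ.NonNegative (1/suc d)
1/suc-nonNeg d = ℚ.pos⇒nonNeg (1/suc d)

1/suc-positive : ∀ d → 0ℚ < 1/suc d
1/suc-positive d = ℚ.positive⁻¹ (1/suc d)

1/suc-*-cancel : ∀ d a → 1/suc d ℚ.* ℕtoℚ (suc d * a) ≡ ℕtoℚ a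
1/suc-*-cancel d a = begin
  1/suc d ℚ.* ℕtoℚ (suc d * a)
    ≡⟨ cong (1/suc d ℚ.*_) (ℕtoℚ-homo-* (suc d) a) ⟩
  1/suc d ℚ.* (ℕtoℚ (suc d) ℚ.* ℕtoℚ a)
    ≡⟨ ℚ.*-assoc (1/suc d) (ℕtoℚ (suc d)) (ℕtoℚ a) ⟨
  1/suc d ℚ.* ℕtoℚ (suc d) ℚ.* ℕtoℚ a
    ≡⟨ cong (λ q → 1/suc d ℚ.* q ℚ.* ℕtoℚ a) (ℕtoℚ≡mkℚ (suc d)) ⟩
  1/suc d ℚ.* suc-d ℚ.* ℕtoℚ a
    ≡⟨ cong (ℚ._* ℕtoℚ a) (ℚ.*-inverseˡ suc-d) ⟩
  1ℚ ℚ.* ℕtoℚ a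
    ≡⟨ ℚ.*-identityˡ (ℕtoℚ a) ⟩
  ℕtoℚ a ∎
  where
  open ≡-Reasoning
  suc-d : ℚ
  suc-d = ℚ.mkℚ (ℤ.+ suc d) 0 (coprime-1 (suc d))

ℕtoℚ-≤-1/suc-* : ∀ d {a b} → suc d * a ≤ b → ℕtoℚ a ℚ.≤ 1/suc d ℚ.* ℕtoℚ b
ℕtoℚ-≤-1/suc-* d {a} {b} da≤b = begin
  ℕtoℚ a
    ≡⟨ 1/suc-*-cancel d a ⟨
  1/suc d ℚ.* ℕtoℚ (suc d * a)
    ≤⟨ ℚ.*-monoˡ-≤-nonNeg (1/suc d) {{1/suc-nonNeg d}} (ℕtoℚ-mono-≤ da≤b) ⟩
  1/suc d ℚ.* ℕtoℚ b ∎
  where open ℚ.≤-Reasoning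

1/suc-*-≤-ℕtoℚ : ∀ d {a b} → b ≤ suc d * a → 1/suc d ℚ.* ℕtoℚ b ℚ.≤ ℕtoℚ a
1/suc-*-≤-ℕtoℚ d {a} {b} b≤da = begin
  1/suc d ℚ.* ℕtoℚ b
    ≤⟨ ℚ.*-monoˡ-≤-nonNeg (1/suc d) {{1/suc-nonNeg d}} (ℕtoℚ-mono-≤ b≤da) ⟩
  1/suc d ℚ.* ℕtoℚ (suc d * a)
    ≡⟨ 1/suc-*-cancel d a ⟩
  ℕtoℚ a ∎
  where open ℚ.≤-Reasoning

1/suc-below : ∀ {μ} → 0ℚ < μ → ∃ λ d → 1/suc d ℚ.≤ μ
1/suc-below {μ} 0<μ = below μ {{ℚ.positive 0<μ}}
  where
  below : ∀ μ → .{{ℚ.Positive μ}} → ∃ λ d → 1/suc d ℚ.≤ μ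
  below (ℚ.mkℚ +[1+ n ] d _) = d , ℚ.*≤* (ℤ.+≤+ (*-monoˡ-≤ (suc d) {1} {suc n} (s≤s z≤n)))

p*x-w≤y : ∀ {p x y z w} → .{{ℚ.NonNegative x}} →
          p ℚ.≤ 1ℚ → x ℚ.≤ y ℚ.+ z → z ℚ.≤ w → p ℚ.* x ℚ.- w ℚ.≤ y
p*x-w≤y {p} {x} {y} {z} {w} p≤1 x≤y+z z≤w = begin
  p ℚ.* x ℚ.- w    ≤⟨ ℚ.+-mono-≤ px≤x (ℚ.neg-antimono-≤ z≤w) ⟩
  x ℚ.- z          ≤⟨ ℚ.+-monoˡ-≤ (ℚ.- z) x≤y+z ⟩
  y ℚ.+ z ℚ.- z    ≡⟨ //-rightDividesʳ z y ⟩
  y                ∎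
  where
  open ℚ.≤-Reasoning
  px≤x : p ℚ.* x ℚ.≤ x
  px≤x = ℚ.≤-trans (ℚ.*-monoʳ-≤-nonNeg x p≤1) (ℚ.≤-reflexive (ℚ.*-identityˡ x))

-- Counting in 3-graphs

<⇒<ᵇ≡true : ∀ {i j} → i ℕ.< j → (i <ᵇ j) ≡ true
<⇒<ᵇ≡true = Equivalence.to T-≡ ∘ <⇒<ᵇ

indicator-product-≤ : ∀ a b c e → ⟦ a ⟧ * ⟦ b ⟧ * ⟦ c ⟧ ≤ ⟦ a ∧ b ∧ c ∧ e ⟧ + ⟦ not e ⟧
indicator-product-≤ false _     _     _     = z≤n
indicator-product-≤ true  false _     _     = z≤n
indicator-product-≤ true  true  false _     = z≤n
indicator-product-≤ true  true  true  true  = ≤-refl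
indicator-product-≤ true  true  true  false = ≤-refl

module _ {m} (H : 3Graph m) where

  nonEdges : ℕ
  nonEdges = ∑³ λ x y z → ⟦ not (E H x y z) ⟧

  E-diag : ∀ v a → E H v a a ≡ false
  E-diag v a = trans (sym₁₂ H v a a) (trans (sym₂₃ H a v a) (loopless H a v))

  deg≡∑² : ∀ v → deg H v ≡ ∑² (λ a b → ⟦ (toℕ a <ᵇ toℕ b) ∧ E H v a b ⟧)
  deg≡∑² v = ΣFin²≡∑² λ a b → ⟦ (toℕ a <ᵇ toℕ b) ∧ E H v a b ⟧

  eH≡∑³ : ∀ X₁ X₂ X₃ → eH H X₁ X₂ X₃ ≡
          ∑³ (λ x y z → ⟦ lookup X₁ x ∧ lookup X₂ y ∧ lookup X₃ z ∧ E H x y z ⟧)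
  eH≡∑³ X₁ X₂ X₃ =
    ΣFin³≡∑³ λ x y z → ⟦ lookup X₁ x ∧ lookup X₂ y ∧ lookup X₃ z ∧ E H x y z ⟧

  cube≤edges+nonEdges : ∀ X₁ X₂ X₃ → ∣ X₁ ∣ * ∣ X₂ ∣ * ∣ X₃ ∣ ≤ eH H X₁ X₂ X₃ + nonEdges
  cube≤edges+nonEdges X₁ X₂ X₃ = begin
    ∣ X₁ ∣ * ∣ X₂ ∣ * ∣ X₃ ∣
      ≡⟨ cong₂ _*_ (cong₂ _*_ (∣∣≡count X₁) (∣∣≡count X₂)) (∣∣≡count X₃) ⟩
    count (lookup X₁) * count (lookup X₂) * count (lookup X₃)
      ≡⟨ ∑³-product (⟦_⟧ ∘ lookup X₁) (⟦_⟧ ∘ lookup X₂) (⟦_⟧ ∘ lookup X₃) ⟨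
    ∑³ (λ x y z → ⟦ lookup X₁ x ⟧ * ⟦ lookup X₂ y ⟧ * ⟦ lookup X₃ z ⟧)
      ≤⟨ ∑³-mono-≤ (λ x y z →
           indicator-product-≤ (lookup X₁ x) (lookup X₂ y) (lookup X₃ z) (E H x y z)) ⟩
    ∑³ (λ x y z → ⟦ lookup X₁ x ∧ lookup X₂ y ∧ lookup X₃ z ∧ E H x y z ⟧
                  + ⟦ not (E H x y z) ⟧)
      ≡⟨ ∑³-distrib-+ _ (λ x y z → ⟦ not (E H x y z) ⟧) ⟩
    ∑³ (λ x y z → ⟦ lookup X₁ x ∧ lookup X₂ y ∧ lookup X₃ z ∧ E H x y z ⟧) + nonEdges
      ≡⟨ cong (_+ nonEdges) (eH≡∑³ X₁ X₂ X₃) ⟨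
    eH H X₁ X₂ X₃ + nonEdges ∎
    where open ≤-Reasoning

  dense-if-few-nonEdges : ∀ {p μ} → p ℚ.≤ 1ℚ →
                          ℕtoℚ nonEdges ℚ.≤ μ ℚ.* ℕtoℚ (m * m * m) → Dense H p μ
  dense-if-few-nonEdges p≤1 few X₁ X₂ X₃ =
    p*x-w≤y {{ℕtoℚ-nonNeg (∣ X₁ ∣ * ∣ X₂ ∣ * ∣ X₃ ∣)}} p≤1 cube≤edges+nonEdgesℚ few
    where
    cube≤edges+nonEdgesℚ :
      ℕtoℚ (∣ X₁ ∣ * ∣ X₂ ∣ * ∣ X₃ ∣) ℚ.≤ ℕtoℚ (eH H X₁ X₂ X₃) ℚ.+ ℕtoℚ nonEdges
    cube≤edges+nonEdgesℚ = ℚ.≤-trans (ℕtoℚ-mono-≤ (cube≤edges+nonEdges X₁ X₂ X₃))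
                                     (ℚ.≤-reflexive (ℕtoℚ-homo-+ (eH H X₁ X₂ X₃) nonEdges))

  ordered-link : ∀ v a b →
    ⟦ E H v a b ⟧ ≤ ⟦ (toℕ a <ᵇ toℕ b) ∧ E H v a b ⟧ + ⟦ (toℕ b <ᵇ toℕ a) ∧ E H v b a ⟧
  ordered-link v a b with <-cmp (toℕ a) (toℕ b)
  ... | tri< a<b _ _ rewrite <⇒<ᵇ≡true a<b = m≤m+n _ _
  ... | tri> _ _ b<a rewrite <⇒<ᵇ≡true b<a | sym₂₃ H v a b = m≤n+m _ _
  ... | tri≈ _ a≡b _ rewrite toℕ-injective a≡b | E-diag v b = z≤n

  ordered-link≤2deg : ∀ v → ∑² (λ a b → ⟦ E H v a b ⟧) ≤ deg H v + deg H v
  ordered-link≤2deg v = begin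
    ∑² (λ a b → ⟦ E H v a b ⟧)
      ≤⟨ ∑²-mono-≤ (ordered-link v) ⟩
    ∑² (λ a b → ⟦ (toℕ a <ᵇ toℕ b) ∧ E H v a b ⟧ + ⟦ (toℕ b <ᵇ toℕ a) ∧ E H v b a ⟧)
      ≤⟨ ∑²-+-≤ {m} (≤-reflexive (sym (deg≡∑² v)))
                    (≤-reflexive (trans swap (sym (deg≡∑² v)))) ⟩
    deg H v + deg H v ∎
    where
    open ≤-Reasoning
    swap : ∑² (λ a b → ⟦ (toℕ b <ᵇ toℕ a) ∧ E H v b a ⟧) ≡
           ∑² (λ a b → ⟦ (toℕ a <ᵇ toℕ b) ∧ E H v a b ⟧)
    swap = ∑-comm (λ a b → ⟦ (toℕ b <ᵇ toℕ a) ∧ E H v b a ⟧)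

  clique-in-link⇒deg : ∀ v (S : Fin m → Bool) →
    (∀ a b → S a ≡ true → S b ≡ true → a ≢ b → v ≢ a → v ≢ b → E H v a b ≡ true) →
    count S * count S ≤ 3 * m + 2 * deg H v
  clique-in-link⇒deg v S clique = begin
    count S * count S
      ≡⟨ ∑-product (⟦_⟧ ∘ S) (⟦_⟧ ∘ S) ⟨
    ∑² (λ a b → ⟦ S a ⟧ * ⟦ S b ⟧)
      ≤⟨ ∑²-mono-≤ pair-bound ⟩
    ∑² (λ a b → ⟦ does (a ≟ b) ⟧ + ⟦ does (v ≟ a) ⟧ + ⟦ does (v ≟ b) ⟧ + ⟦ E H v a b ⟧)
      ≤⟨ ∑²-+-≤ {m} (∑²-+-≤ {m} (∑²-+-≤ {m} (∑²-≤-via-b {m} (≤-reflexive ∘ ∑-indicator-≟))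
                                             (∑²-≤-via-a {m} λ _ → ≤-reflexive (∑-indicator-≟ v)))
                                (∑²-≤-via-b {m} λ _ → ≤-reflexive (∑-indicator-≟ v)))
                    (ordered-link≤2deg v) ⟩
    m * 1 + m * 1 + m * 1 + (deg H v + deg H v)
      ≡⟨ collect m (deg H v) ⟩
    3 * m + 2 * deg H v ∎
    where
    open ≤-Reasoning
    collect : ∀ m g → m * 1 + m * 1 + m * 1 + (g + g) ≡ 3 * m + 2 * g
    collect = solve-∀
    pair-bound : ∀ a b → ⟦ S a ⟧ * ⟦ S b ⟧ ≤
                 ⟦ does (a ≟ b) ⟧ + ⟦ does (v ≟ a) ⟧ + ⟦ does (v ≟ b) ⟧ + ⟦ E H v a b ⟧
    pair-bound a b with S a in Sa | S b in Sb | a ≟ b | v ≟ a | v ≟ b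
    ... | false | _     | _       | _       | _       = z≤n
    ... | true  | false | _       | _       | _       = z≤n
    ... | true  | true  | yes _   | _       | _       = s≤s z≤n
    ... | true  | true  | no _    | yes _   | _       = s≤s z≤n
    ... | true  | true  | no _    | no _    | yes _   = s≤s z≤n
    ... | true  | true  | no a≢b  | no v≢a  | no v≢b
      rewrite clique a b Sa Sb a≢b v≢a v≢b = s≤s z≤n

-- Weighted 3-graphs

does-true⇒ : ∀ {a} {A : Set a} (a? : Dec A) → does a? ≡ true → A
does-true⇒ (yes a) _ = a

module _ {m} (w : Fin m → ℕ) {P : ℕ → Set} (P? : Decidable P) where

  WeightedEdge : Fin m → Fin m → Fin m → Set
  WeightedEdge x y z = x ≢ y × y ≢ z × x ≢ z × P (w x + w y + w z)

  weightedEdge? : ∀ x y z → Dec (WeightedEdge x y z)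
  weightedEdge? x y z = ¬? (x ≟ y) ×-dec ¬? (y ≟ z) ×-dec ¬? (x ≟ z) ×-dec P? (w x + w y + w z)

  WeightedEdge-swap₁₂ : ∀ {x y z} → WeightedEdge x y z → WeightedEdge y x z
  WeightedEdge-swap₁₂ {x} {y} {z} (x≢y , y≢z , x≢z , p) =
    ≢-sym x≢y , x≢z , y≢z , subst P (xy∙z≈yx∙z (w x) (w y) (w z)) p

  WeightedEdge-swap₂₃ : ∀ {x y z} → WeightedEdge x y z → WeightedEdge x z y
  WeightedEdge-swap₂₃ {x} {y} {z} (x≢y , y≢z , x≢z , p) =
    x≢z , ≢-sym y≢z , x≢y , subst P (xy∙z≈xz∙y (w x) (w y) (w z)) p

  weightedGraph : 3Graph m
  weightedGraph = record
    { E        = λ x y z → does (weightedEdge? x y z)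
    ; sym₁₂    = λ x y z → does-⇔ (mk⇔ WeightedEdge-swap₁₂ WeightedEdge-swap₁₂)
                                  (weightedEdge? x y z) (weightedEdge? y x z)
    ; sym₂₃    = λ x y z → does-⇔ (mk⇔ WeightedEdge-swap₂₃ WeightedEdge-swap₂₃)
                                  (weightedEdge? x y z) (weightedEdge? x z y)
    ; loopless = λ x z → dec-false (weightedEdge? x x z) λ (x≢x , _) → x≢x refl
    }

  nonEdge-indicator-≤ : P 0 → ∀ x y z → ⟦ not (does (weightedEdge? x y z)) ⟧ ≤
    ⟦ does (x ≟ y) ⟧ + ⟦ does (y ≟ z) ⟧ + ⟦ does (x ≟ z) ⟧ + (w x + w y + w z)
  nonEdge-indicator-≤ P0 x y z with x ≟ y | y ≟ z | x ≟ z | P? (w x + w y + w z)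
  ... | yes _ | _     | _     | _     = s≤s z≤n
  ... | no _  | yes _ | _     | _     = s≤s z≤n
  ... | no _  | no _  | yes _ | _     = s≤s z≤n
  ... | no _  | no _  | no _  | yes _ = z≤n
  ... | no _  | no _  | no _  | no ¬p = n≢0⇒n>0 λ weight≡0 → ¬p (subst P (sym weight≡0) P0)

  nonEdges-weightedGraph : P 0 → nonEdges weightedGraph ≤ 3 * (m * m) * (1 + sum w)
  nonEdges-weightedGraph P0 = begin
    nonEdges weightedGraph
      ≤⟨ ∑³-mono-≤ (nonEdge-indicator-≤ P0) ⟩
    ∑³ (λ x y z → ⟦ does (x ≟ y) ⟧ + ⟦ does (y ≟ z) ⟧ + ⟦ does (x ≟ z) ⟧ + (w x + w y + w z))
      ≤⟨ ∑³-+-≤ {m} (∑³-+-≤ {m} (∑³-+-≤ {m} (∑³-≤-via-y {m} λ x _ → ≤-reflexive (∑-indicator-≟ x))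
                                             (∑³-≤-via-z {m} λ _ y → ≤-reflexive (∑-indicator-≟ y)))
                                (∑³-≤-via-z {m} λ x _ → ≤-reflexive (∑-indicator-≟ x)))
                    (∑³-+-≤ {m} (∑³-+-≤ {m} (∑³-≤-via-x {m} λ _ _ → ≤-refl)
                                             (∑³-≤-via-y {m} λ _ _ → ≤-refl))
                                (∑³-≤-via-z {m} λ _ _ → ≤-refl)) ⟩
    m * (m * 1) + m * (m * 1) + m * (m * 1) + (m * (m * W) + m * (m * W) + m * (m * W))
      ≡⟨ collect m W ⟩
    3 * (m * m) * (1 + W) ∎
    where
    open ≤-Reasoning
    W : ℕ
    W = sum w
    collect : ∀ m W → m * (m * 1) + m * (m * 1) + m * (m * 1) + (m * (m * W) + m * (m * W) + m * (m * W))
                      ≡ 3 * (m * m) * (1 + W)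
    collect = solve-∀

-- The apex construction

-- Vertex 0 is the apex o (weight 2) and 1, …, k form A (weight 1). Among distinct triples, total weight
-- 0 or 1 means avoiding o with at most one vertex of A, and total weight 4 means o with two vertices of A.
apexWeight : ∀ {n} → ℕ → Fin (suc n) → ℕ
apexWeight k zero    = 2
apexWeight k (suc x) = ⟦ toℕ x <ᵇ k ⟧

Admissible : ℕ → Set
Admissible s = s ≤ 1 ⊎ s ≡ 4

admissible? : Decidable Admissible
admissible? s = s ≤? 1 ⊎-dec s ℕ.≟ 4

apexGraph : ∀ n → ℕ → 3Graph (suc n)
apexGraph n k = weightedGraph (apexWeight k) admissible?

ApexEdge : ∀ {n} → ℕ → Fin (suc n) → Fin (suc n) → Fin (suc n) → Set
ApexEdge k = WeightedEdge (apexWeight k) admissible?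

apex-admissible : ∀ b c → Admissible (2 + ⟦ b ⟧ + ⟦ c ⟧) → ⟦ b ⟧ ≡ 1 × ⟦ c ⟧ ≡ 1
apex-admissible true  true  _                = refl , refl
apex-admissible true  false (inj₁ (s≤s ()))
apex-admissible true  false (inj₂ ())
apex-admissible false true  (inj₁ (s≤s ()))
apex-admissible false true  (inj₂ ())
apex-admissible false false (inj₁ (s≤s ()))
apex-admissible false false (inj₂ ())

two-marked-inadmissible : ∀ b → ¬ Admissible (⟦ b ⟧ + 1 + 1)
two-marked-inadmissible true  (inj₁ (s≤s ()))
two-marked-inadmissible true  (inj₂ ())
two-marked-inadmissible false (inj₁ (s≤s ()))
two-marked-inadmissible false (inj₂ ())

apex-link : ∀ {n k} {y z : Fin (suc n)} → ApexEdge k zero y z → apexWeight k y ≡ 1 × apexWeight k z ≡ 1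
apex-link {y = zero}            (0≢0 , _)         = ⊥-elim (0≢0 refl)
apex-link {y = suc _} {zero}    (_ , _ , 0≢0 , _) = ⊥-elim (0≢0 refl)
apex-link {y = suc y} {suc z}   (_ , _ , _ , adm) = apex-admissible _ _ adm

marked-pair-outside-link : ∀ {n k} {v y z : Fin (suc n)} → v ≢ zero →
  apexWeight k y ≡ 1 → apexWeight k z ≡ 1 → ¬ ApexEdge k v y z
marked-pair-outside-link {v = zero}  v≢0 _ _ _ = v≢0 refl
marked-pair-outside-link {k = k} {v = suc v} {suc _} {suc _} _ wy wz (_ , _ , _ , adm) =
  two-marked-inadmissible (toℕ v <ᵇ k)
    (subst₂ (λ p q → Admissible (⟦ toℕ v <ᵇ k ⟧ + p + q)) wy wz adm)

apexGraph-noFactor : ∀ {f} (F : 3Graph f) → SharedLinkPair F → ∀ n k → ¬ HasFactor F (apexGraph n k)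
apexGraph-noFactor F shared n k (_ , φ , copy , _ , cover) with cover zero
... | i , a , φa≡0 with shared a
... | u , u≢a , c , d , Facd , Fucd =
  marked-pair-outside-link φu≢0 (proj₁ φc,φd-marked) (proj₂ φc,φd-marked) (edge Fucd)
  where
  edge : ∀ {x y z} → E F x y z ≡ true → ApexEdge k (φ i x) (φ i y) (φ i z)
  edge e = does-true⇒ (weightedEdge? (apexWeight k) admissible? _ _ _) (proj₂ (copy i) _ _ _ e)
  φc,φd-marked : apexWeight k (φ i c) ≡ 1 × apexWeight k (φ i d) ≡ 1
  φc,φd-marked = apex-link (subst (λ o → ApexEdge k o (φ i c) (φ i d)) φa≡0 (edge Facd))
  φu≢0 : φ i u ≢ zero
  φu≢0 φu≡0 = u≢a (proj₁ (copy i) (trans φu≡0 (sym φa≡0)))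

hasWeight : ∀ {n} → ℕ → ℕ → Fin (suc n) → Bool
hasWeight k j a = does (apexWeight k a ℕ.≟ j)

sum-apexWeight : ∀ {n k} → k ≤ n → sum (apexWeight {n} k) ≡ 2 + k
sum-apexWeight {n} {k} k≤n = cong (2 +_) (begin
  ∑[ x < n ] ⟦ toℕ x <ᵇ k ⟧ ≡⟨ ∑-threshold ⟦_⟧ n k k≤n ⟩
  k * 1 + (n ∸ k) * 0        ≡⟨ cong₂ _+_ (*-identityʳ k) (*-zeroʳ (n ∸ k)) ⟩
  k + 0                      ≡⟨ +-identityʳ k ⟩
  k                          ∎)
  where open ≡-Reasoning

count-hasWeight-1 : ∀ {n k} → k ≤ n → count (hasWeight {n} k 1) ≡ k
count-hasWeight-1 {n} {k} k≤n = begin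
  ∑[ x < n ] ⟦ does (⟦ toℕ x <ᵇ k ⟧ ℕ.≟ 1) ⟧
    ≡⟨ ∑-threshold (λ b → ⟦ does (⟦ b ⟧ ℕ.≟ 1) ⟧) n k k≤n ⟩
  k * 1 + (n ∸ k) * 0
    ≡⟨ cong₂ _+_ (*-identityʳ k) (*-zeroʳ (n ∸ k)) ⟩
  k + 0
    ≡⟨ +-identityʳ k ⟩
  k ∎
  where open ≡-Reasoning

count-hasWeight-0 : ∀ {n k} → k ≤ n → count (hasWeight {n} k 0) ≡ n ∸ k
count-hasWeight-0 {n} {k} k≤n = begin
  ∑[ x < n ] ⟦ does (⟦ toℕ x <ᵇ k ⟧ ℕ.≟ 0) ⟧
    ≡⟨ ∑-threshold (λ b → ⟦ does (⟦ b ⟧ ℕ.≟ 0) ⟧) n k k≤n ⟩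
  k * 0 + (n ∸ k) * 1
    ≡⟨ cong (_+ (n ∸ k) * 1) (*-zeroʳ k) ⟩
  (n ∸ k) * 1
    ≡⟨ *-identityʳ (n ∸ k) ⟩
  n ∸ k ∎
  where open ≡-Reasoning

indicator+0+0≤1 : ∀ b → ⟦ b ⟧ + 0 + 0 ≤ 1
indicator+0+0≤1 true  = ≤-refl
indicator+0+0≤1 false = z≤n

apexGraph-degree : ∀ {n k} → k + k ≤ n → ∀ v → k * k ≤ 3 * suc n + 2 * deg (apexGraph n k) v
apexGraph-degree {n} {k} 2k≤n zero =
  subst (λ c → c * c ≤ 3 * suc n + 2 * deg (apexGraph n k) zero) (count-hasWeight-1 {n} k≤n)
        (clique-in-link⇒deg (apexGraph n k) zero (hasWeight k 1) marked-clique)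
  where
  k≤n : k ≤ n
  k≤n = m+n≤o⇒m≤o k 2k≤n
  marked-clique : ∀ a b → hasWeight k 1 a ≡ true → hasWeight k 1 b ≡ true →
                  a ≢ b → zero ≢ a → zero ≢ b → E (apexGraph n k) zero a b ≡ true
  marked-clique a b a-marked b-marked a≢b 0≢a 0≢b =
    dec-true (weightedEdge? (apexWeight k) admissible? zero a b)
      (0≢a , a≢b , 0≢b , inj₂ (cong₂ (λ p q → 2 + p + q)
        (does-true⇒ (apexWeight k a ℕ.≟ 1) a-marked) (does-true⇒ (apexWeight k b ℕ.≟ 1) b-marked)))
apexGraph-degree {n} {k} 2k≤n (suc x) = begin
  k * k
    ≤⟨ *-mono-≤ k≤n∸k k≤n∸k ⟩
  (n ∸ k) * (n ∸ k)
    ≡⟨ cong₂ _*_ (count-hasWeight-0 {n} k≤n) (count-hasWeight-0 {n} k≤n) ⟨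
  count (hasWeight {n} k 0) * count (hasWeight {n} k 0)
    ≤⟨ clique-in-link⇒deg (apexGraph n k) (suc x) (hasWeight k 0) unmarked-clique ⟩
  3 * suc n + 2 * deg (apexGraph n k) (suc x) ∎
  where
  open ≤-Reasoning
  k≤n∸k : k ≤ n ∸ k
  k≤n∸k = m+n≤o⇒m≤o∸n k 2k≤n
  k≤n : k ≤ n
  k≤n = m+n≤o⇒m≤o k 2k≤n
  unmarked-clique : ∀ a b → hasWeight k 0 a ≡ true → hasWeight k 0 b ≡ true →
                    a ≢ b → suc x ≢ a → suc x ≢ b → E (apexGraph n k) (suc x) a b ≡ true
  unmarked-clique a b a-unmarked b-unmarked a≢b x≢a x≢b =
    dec-true (weightedEdge? (apexWeight k) admissible? (suc x) a b)
      (x≢a , a≢b , x≢b , inj₁ (subst₂ (λ p q → ⟦ toℕ x <ᵇ k ⟧ + p + q ≤ 1)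
        (sym (does-true⇒ (apexWeight k a ℕ.≟ 0) a-unmarked))
        (sym (does-true⇒ (apexWeight k b ℕ.≟ 0) b-unmarked))
        (indicator+0+0≤1 (toℕ x <ᵇ k))))

apexGraph-nonEdges : ∀ {n k} → k ≤ n → nonEdges (apexGraph n k) ≤ 3 * (suc n * suc n) * (3 + k)
apexGraph-nonEdges {n} {k} k≤n =
  subst (λ W → nonEdges (apexGraph n k) ≤ 3 * (suc n * suc n) * (1 + W)) (sum-apexWeight {n} k≤n)
        (nonEdges-weightedGraph (apexWeight {n} k) admissible? (inj₁ z≤n))

-- Choice of parameters

floor-bounds : ∀ N M .{{_ : NonZero M}} → M ≤ N → N / M * M ≤ N × N ≤ 2 * (N / M * M)
floor-bounds N M M≤N = m/n*n≤m N M , (begin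
  N                      ≡⟨ m≡m%n+[m/n]*n N M ⟩
  N % M + N / M * M      ≤⟨ +-monoˡ-≤ (N / M * M) (≤-trans (<⇒≤ (m%n<n N M)) M≤kM) ⟩
  N / M * M + N / M * M  ≡⟨ cong (N / M * M +_) (+-identityʳ (N / M * M)) ⟨
  2 * (N / M * M)        ∎)
  where
  open ≤-Reasoning
  M≤kM : M ≤ N / M * M
  M≤kM = m≤n*m M (N / M) {{>-nonZero (m≥n⇒m/n>0 M≤N)}}

3*k≤1+n⇒k+k≤n : ∀ k n → 3 * k ≤ suc n → k + k ≤ n
3*k≤1+n⇒k+k≤n zero    n _    = z≤n
3*k≤1+n⇒k+k≤n (suc j) n 3k≤N =
  ≤-pred (≤-trans (≤-trans (m≤m+n _ j) (≤-reflexive (sym (regroup j)))) 3k≤N)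
  where
  regroup : ∀ j → 3 * suc j ≡ suc (suc j + suc j) + j
  regroup = solve-∀

density-arithmetic : ∀ D N k → k * (6 * D) ≤ N → 18 * D ≤ N → D * (3 * (N * N) * (3 + k)) ≤ N * N * N
density-arithmetic D N k 6Dk≤N 18D≤N = *-cancelˡ-≤ 2 (begin
  2 * (D * (3 * (N * N) * (3 + k)))  ≡⟨ expand D N k ⟩
  N * N * (k * (6 * D) + 18 * D)     ≤⟨ *-monoʳ-≤ (N * N) (+-mono-≤ 6Dk≤N 18D≤N) ⟩
  N * N * (N + N)                    ≡⟨ double N ⟩
  2 * (N * N * N)                    ∎)
  where
  open ≤-Reasoning
  expand : ∀ D N k → 2 * (D * (3 * (N * N) * (3 + k))) ≡ N * N * (k * (6 * D) + 18 * D)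
  expand = solve-∀
  double : ∀ N → N * N * (N + N) ≡ 2 * (N * N * N)
  double = solve-∀

degree-arithmetic : ∀ M N k g → N ≤ 2 * (k * M) → 24 * (M * M) ≤ N →
                    k * k ≤ 3 * N + 2 * g → N * N ≤ 16 * (M * M) * g
degree-arithmetic M N k g N≤2kM 24M²≤N k²≤3N+2g = +-cancelˡ-≤ (N * N) _ _ (begin
  N * N + N * N                        ≡⟨ double (N * N) ⟩
  2 * (N * N)                          ≤⟨ *-monoʳ-≤ 2 (*-mono-≤ N≤2kM N≤2kM) ⟩
  2 * (2 * (k * M) * (2 * (k * M)))    ≡⟨ regroup k M ⟩
  8 * (M * M) * (k * k)                ≤⟨ *-monoʳ-≤ (8 * (M * M)) k²≤3N+2g ⟩
  8 * (M * M) * (3 * N + 2 * g)        ≡⟨ expand M N g ⟩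
  24 * (M * M) * N + 16 * (M * M) * g  ≤⟨ +-monoˡ-≤ (16 * (M * M) * g) (*-monoˡ-≤ N 24M²≤N) ⟩
  N * N + 16 * (M * M) * g             ∎)
  where
  open ≤-Reasoning
  double : ∀ x → x + x ≡ 2 * x
  double = solve-∀
  regroup : ∀ k M → 2 * (2 * (k * M) * (2 * (k * M))) ≡ 8 * (M * M) * (k * k)
  regroup = solve-∀
  expand : ∀ M N g → 8 * (M * M) * (3 * N + 2 * g) ≡ 24 * (M * M) * N + 16 * (M * M) * g
  expand = solve-∀

-- With M = 6(d+1) and k = ⌊N/M⌋ marked vertices, 3(d+1)(k+3) ≤ N bounds the non-edges by N³/(d+1),
-- and N ≤ 2kM turns k² ≤ 3N + 2 deg v into N² ≤ 16M² deg v once N ≥ 24M².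
markRatio : ℕ → ℕ
markRatio d = 6 * suc d

scaledApexGraph : ℕ → ∀ n → 3Graph (suc n)
scaledApexGraph d n = apexGraph n (suc n / markRatio d)

scaledApexGraph-bounds : ∀ d n → 24 * (markRatio d * markRatio d) ≤ suc n →
  suc d * nonEdges (scaledApexGraph d n) ≤ suc n * suc n * suc n ×
  (∀ v → suc n * suc n ≤ 16 * (markRatio d * markRatio d) * deg (scaledApexGraph d n) v)
scaledApexGraph-bounds d n large =
  ≤-trans (*-monoʳ-≤ (suc d) (apexGraph-nonEdges k≤n)) (density-arithmetic (suc d) N k kM≤N 18D≤N) ,
  λ v → degree-arithmetic M N k _ N≤2kM large (apexGraph-degree 2k≤n v)
  where
  M N k : ℕ
  M = markRatio d
  N = suc n
  k = N / M
  M≤M² : M ≤ M * M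
  M≤M² = m≤m*n M M
  M≤N : M ≤ N
  M≤N = ≤-trans M≤M² (≤-trans (m≤n*m (M * M) 24) large)
  kM≤N : k * M ≤ N
  kM≤N = proj₁ (floor-bounds N M M≤N)
  N≤2kM : N ≤ 2 * (k * M)
  N≤2kM = proj₂ (floor-bounds N M M≤N)
  18D≤N : 18 * suc d ≤ N
  18D≤N = ≤-trans (*-mono-≤ (m≤m+n 18 6) (≤-trans (m≤n*m (suc d) 6) M≤M²)) large
  3k≤N : 3 * k ≤ N
  3k≤N = ≤-trans (*-monoˡ-≤ k 3≤M) (≤-trans (≤-reflexive (*-comm M k)) kM≤N)
    where
    3≤M : 3 ≤ M
    3≤M = ≤-trans (m≤m+n 3 3) (m≤m*n 6 (suc d))
  2k≤n : k + k ≤ n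
  2k≤n = 3*k≤1+n⇒k+k≤n k n 3k≤N
  k≤n : k ≤ n
  k≤n = m+n≤o⇒m≤o k 2k≤n

theorem1p6 : ∀ {f} (F : 3Graph f) → SharedLinkPair F →
    ∀ (p μ : ℚ) → 0ℚ < p → p < 1ℚ → 0ℚ < μ →
    Σ ℕ λ n₀ → Σ ℚ λ α → 0ℚ < α ×
      (∀ (n : ℕ) → n ≥ n₀ →
        Σ (3Graph n) λ H → Dense H p μ × MinDeg≥ H α × ¬ HasFactor F H)
theorem1p6 F shared p μ _ p<1 0<μ = 24 * (M * M) , 1/suc s , 1/suc-positive s , host
  where
  d M s : ℕ
  d = proj₁ (1/suc-below 0<μ)
  M = markRatio d
  s = 16 * (M * M)
  host : ∀ N → N ≥ 24 * (M * M) →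
         Σ (3Graph N) λ H → Dense H p μ × MinDeg≥ H (1/suc s) × ¬ HasFactor F H
  host zero ()
  host (suc n) large = scaledApexGraph d n , dense , minDeg , apexGraph-noFactor F shared n (suc n / M)
    where
    N³ : ℕ
    N³ = suc n * suc n * suc n
    dense : Dense (scaledApexGraph d n) p μ
    dense = dense-if-few-nonEdges (scaledApexGraph d n) {p} {μ} (ℚ.<⇒≤ p<1) (begin
      ℕtoℚ (nonEdges (scaledApexGraph d n))
        ≤⟨ ℕtoℚ-≤-1/suc-* d (proj₁ (scaledApexGraph-bounds d n large)) ⟩
      1/suc d ℚ.* ℕtoℚ N³
        ≤⟨ ℚ.*-monoʳ-≤-nonNeg (ℕtoℚ N³) {{ℕtoℚ-nonNeg N³}} (proj₂ (1/suc-below 0<μ)) ⟩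
      μ ℚ.* ℕtoℚ N³ ∎)
      where open ℚ.≤-Reasoning
    minDeg : MinDeg≥ (scaledApexGraph d n) (1/suc s)
    minDeg v = 1/suc-*-≤-ℕtoℚ s {deg (scaledApexGraph d n) v}
      (≤-trans (proj₂ (scaledApexGraph-bounds d n large) v) (*-monoˡ-≤ _ (n≤1+n s)))
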